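{- Suppose $\Gamma\vdash u:\exists\alpha A$ in $\mathsf{LC}$ and $u$ is an Herbrand normal form $$u=(m_0,v_0)\parallel_{a_1}(m_1,v_1)\parallel_{a_2}\cdots\parallel_{a_k}(m_k,v_k)$$ (parentheses omitted). Then there is a proof term $u^+$ with $\Gamma\vdash u^+:A[m_0/\alpha]\vee A[m_1/\alpha]\vee\cdots\vee A[m_k/\alpha]$.
   Context: Formulas of the first-order language $\mathcal L$: terms are individual variables, constants and $f(m_1,\dots,m_n)$; atomic formulas $P(m_1,\dots,m_n)$ including $\bot$; connectives $\wedge,\vee,\to,\forall\alpha,\exists\alpha$. Proof terms of $\mathsf{LC}$ (Church-typed): $x^A:A$; $\langle u,t\rangle:A\wedge B$ from $u:A,t:B$; $u\pi_0:A$, $u\pi_1:B$ from $u:A\wedge B$; $tu:B$ from $t:A\to B,u:A$; $\lambda x^Au:A\to B$ from $u:B$; $\iota_0(u):A\vee B$ from $u:A$, $\iota_1(u):A\vee B$ from $u:B$; $u[x^A.w_1,y^B.w_2]:C$ from $u:A\vee B$, $w_1,w_2:C$; $um:A[m/\alpha]$ from $u:\forall\alpha A$; $\lambda\alpha u:\forall\alpha A$ from $u:A$ ($\alpha$ not free in types of free proof variables of $u$); $(m,u):\exists\alpha A$ from $u:A[m/\alpha]$; $u[(\alpha,x^A).t]:C$ from $u:\exists\alpha A$, $t:C$ (usual eigenvariable condition); $u\parallel_a v:C$ from $u:C$, $v:C$, where $a$ occurs in $u$ with type $A\to B$ and in $v$ with type $B\to A$, $\parallel_a$ binding $a$; $\mathsf{efq}_P(u):P$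 from $u:\bot$, $P$ atomic. $\Gamma\vdash t:A$, with $\Gamma=x_1:A_1,\dots,x_n:A_n$, means $t:A$ and all free proof variables of $t$ are among $x_1,\dots,x_n$. Herbrand normal forms are defined inductively: every proof term $(m,u)$ is an Herbrand normal form; if $u$ and $v$ are Herbrand normal forms, so is $u\parallel_a v$. -}

module Defs where

open import Data.Nat using (ℕ; zero; suc)
open import Data.Fin using (Fin; zero; suc)
open import Data.Vec using (Vec; []; _∷_)
open import Data.List using (List; []; _∷_)
import Data.List as List
open import Data.List.NonEmpty using (List⁺; _∷_; _⁺++⁺_)
open import Data.List.Membership.Propositional using (_∈_)

record Signature : Set₁ where
  field
    Const     : Set
    Fun       : Set
    funArity  : Fun → ℕ
    Pred      : Set
    predArity : Pred → ℕ

module LC (S : Signature) where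
  open Signature S

  data Term (n : ℕ) : Set where
    var : Fin n → Term n
    con : Const → Term n
    fun : (f : Fun) → Vec (Term n) (funArity f) → Term n

  mutual
    renT : ∀ {n m} → (Fin n → Fin m) → Term n → Term m
    renT ρ (var i)    = var (ρ i)
    renT ρ (con c)    = con c
    renT ρ (fun f ts) = fun f (renTs ρ ts)

    renTs : ∀ {n m k} → (Fin n → Fin m) → Vec (Term n) k → Vec (Term m) k
    renTs ρ []       = []
    renTs ρ (t ∷ ts) = renT ρ t ∷ renTs ρ ts

  mutual
    subT : ∀ {n m} → (Fin n → Term m) → Term n → Term m
    subT σ (var i)    = σ i
    subT σ (con c)    = con c
    subT σ (fun f ts) = fun f (subTs σ ts)

    subTs : ∀ {n m k} → (Fin n → Term m) → Vec (Term n) k → Vec (Term m) k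
    subTs σ []       = []
    subTs σ (t ∷ ts) = subT σ t ∷ subTs σ ts

  liftR : ∀ {n m} → (Fin n → Fin m) → Fin (suc n) → Fin (suc m)
  liftR ρ zero    = zero
  liftR ρ (suc i) = suc (ρ i)

  liftS : ∀ {n m} → (Fin n → Term m) → Fin (suc n) → Term (suc m)
  liftS σ zero    = var zero
  liftS σ (suc i) = renT suc (σ i)

  -- Formulas with n free individual variables; ∀' and ∃' bind variable 0.
  infixr 6 _∧'_
  infixr 5 _∨'_
  infixr 4 _⇒_
  data Form (n : ℕ) : Set where
    atom : (P : Pred) → Vec (Term n) (predArity P) → Form n
    ⊥'   : Form n
    _∧'_ : Form n → Form n → Form n
    _∨'_ : Form n → Form n → Form n
    _⇒_  : Form n → Form n → Form n
    ∀'   : Form (suc n) → Form n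
    ∃'   : Form (suc n) → Form n

  renF : ∀ {n m} → (Fin n → Fin m) → Form n → Form m
  renF ρ (atom P ts) = atom P (renTs ρ ts)
  renF ρ ⊥'          = ⊥'
  renF ρ (A ∧' B)    = renF ρ A ∧' renF ρ B
  renF ρ (A ∨' B)    = renF ρ A ∨' renF ρ B
  renF ρ (A ⇒ B)     = renF ρ A ⇒ renF ρ B
  renF ρ (∀' A)      = ∀' (renF (liftR ρ) A)
  renF ρ (∃' A)      = ∃' (renF (liftR ρ) A)

  subF : ∀ {n m} → (Fin n → Term m) → Form n → Form m
  subF σ (atom P ts) = atom P (subTs σ ts)
  subF σ ⊥'          = ⊥'
  subF σ (A ∧' B)    = subF σ A ∧' subF σ B
  subF σ (A ∨' B)    = subF σ A ∨' subF σ B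
  subF σ (A ⇒ B)     = subF σ A ⇒ subF σ B
  subF σ (∀' A)      = ∀' (subF (liftS σ) A)
  subF σ (∃' A)      = ∃' (subF (liftS σ) A)

  sub0 : ∀ {n} → Term n → Fin (suc n) → Term n
  sub0 m zero    = m
  sub0 m (suc i) = var i

  _[_] : ∀ {n} → Form (suc n) → Term n → Form n
  A [ m ] = subF (sub0 m) A

  -- weakening by a fresh individual variable (for eigenvariable conditions)
  wkF : ∀ {n} → Form n → Form (suc n)
  wkF = renF suc

  Ctx : ℕ → Set
  Ctx n = List (Form n)

  wkCtx : ∀ {n} → Ctx n → Ctx (suc n)
  wkCtx = List.map wkF

  data Atomic {n} : Form n → Set where
    atomic : ∀ P ts → Atomic (atom P ts)
    bot    : Atomic ⊥'

  infix 2 _⊢_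
  data _⊢_ : ∀ {n} → Ctx n → Form n → Set where
    pvar  : ∀ {n} {Γ : Ctx n} {A} → A ∈ Γ → Γ ⊢ A
    pair  : ∀ {n} {Γ : Ctx n} {A B} → Γ ⊢ A → Γ ⊢ B → Γ ⊢ A ∧' B
    π₀    : ∀ {n} {Γ : Ctx n} {A B} → Γ ⊢ A ∧' B → Γ ⊢ A
    π₁    : ∀ {n} {Γ : Ctx n} {A B} → Γ ⊢ A ∧' B → Γ ⊢ B
    app   : ∀ {n} {Γ : Ctx n} {A B} → Γ ⊢ A ⇒ B → Γ ⊢ A → Γ ⊢ B
    lam   : ∀ {n} {Γ : Ctx n} {A B} → A ∷ Γ ⊢ B → Γ ⊢ A ⇒ B
    ι₀    : ∀ {n} {Γ : Ctx n} {A B} → Γ ⊢ A → Γ ⊢ A ∨' B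
    ι₁    : ∀ {n} {Γ : Ctx n} {A B} → Γ ⊢ B → Γ ⊢ A ∨' B
    case  : ∀ {n} {Γ : Ctx n} {A B C} →
            Γ ⊢ A ∨' B → A ∷ Γ ⊢ C → B ∷ Γ ⊢ C → Γ ⊢ C
    appT  : ∀ {n} {Γ : Ctx n} {A} → Γ ⊢ ∀' A → (m : Term n) → Γ ⊢ A [ m ]
    lamT  : ∀ {n} {Γ : Ctx n} {A} → wkCtx Γ ⊢ A → Γ ⊢ ∀' A
    wit   : ∀ {n} {Γ : Ctx n} {A} → (m : Term n) → Γ ⊢ A [ m ] → Γ ⊢ ∃' A
    exE   : ∀ {n} {Γ : Ctx n} {A C} →
            Γ ⊢ ∃' A → A ∷ wkCtx Γ ⊢ wkF C → Γ ⊢ C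
    par   : ∀ {n} {Γ : Ctx n} {A B C} →
            (A ⇒ B) ∷ Γ ⊢ C → (B ⇒ A) ∷ Γ ⊢ C → Γ ⊢ C
    efq   : ∀ {n} {Γ : Ctx n} {P} → Atomic P → Γ ⊢ ⊥' → Γ ⊢ P

  -- Herbrand normal forms of type ∃α A, indexed by the (left-to-right)
  -- list of witnesses m₀,…,m_k occurring in them.
  data HNF {n} {A : Form (suc n)} : {Γ : Ctx n} → Γ ⊢ ∃' A → List⁺ (Term n) → Set where
    hwit : ∀ {Γ} (m : Term n) (v : Γ ⊢ A [ m ]) → HNF (wit m v) (m ∷ [])
    hpar : ∀ {Γ B C} {u : (B ⇒ C) ∷ Γ ⊢ ∃' A} {v : (C ⇒ B) ∷ Γ ⊢ ∃' A} {ms ns} →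
           HNF u ms → HNF v ns → HNF (par u v) (ms ⁺++⁺ ns)

  ⋁-aux : ∀ {n} → Form n → List (Form n) → Form n
  ⋁-aux A []       = A
  ⋁-aux A (B ∷ Bs) = A ∨' ⋁-aux B Bs

  ⋁ : ∀ {n} → List⁺ (Form n) → Form n
  ⋁ (A ∷ As) = ⋁-aux A As

module Submission where

-- For
-- u ∥_a w the two components prove the disjunctions of their own
-- witnesses (in contexts extended by a : B → C resp. a : C → B), and
-- the disjunction of the witnesses of u ∥_a w is the concatenation of
-- these two.  So it suffices to inject each component's disjunction
-- into the concatenated one and to recombine the two injected proofs
-- with ∥_a again.

open import Defs
open import Data.Nat using (suc)
open import Data.List using (List; []; _∷_; _++_)
open import Data.List.NonEmpty using (List⁺; _∷_; _⁺++⁺_)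
import Data.List.NonEmpty as List⁺
open import Data.List.NonEmpty.Properties using (map-⁺++⁺)
open import Data.List.Relation.Unary.Any using (here)
open import Relation.Binary.PropositionalEquality using (refl; sym; subst)

module Herbrand (S : Signature) where
  open LC S

  ⋁-aux-injˡ : ∀ {n} {Δ : Ctx n} A As B Bs →
               Δ ⊢ ⋁-aux A As → Δ ⊢ ⋁-aux A (As ++ B ∷ Bs)
  ⋁-aux-injˡ A []        B Bs t = ι₀ t
  ⋁-aux-injˡ A (A′ ∷ As) B Bs t =
    case t (ι₀ (pvar (here refl)))
           (ι₁ (⋁-aux-injˡ A′ As B Bs (pvar (here refl))))

  ⋁-aux-injʳ : ∀ {n} {Δ : Ctx n} A As B Bs →
               Δ ⊢ ⋁-aux B Bs → Δ ⊢ ⋁-aux A (As ++ B ∷ Bs)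
  ⋁-aux-injʳ A []        B Bs t = ι₁ t
  ⋁-aux-injʳ A (A′ ∷ As) B Bs t = ι₁ (⋁-aux-injʳ A′ As B Bs t)

  ⋁-injˡ : ∀ {n} {Δ : Ctx n} (As Bs : List⁺ (Form n)) →
           Δ ⊢ ⋁ As → Δ ⊢ ⋁ (As ⁺++⁺ Bs)
  ⋁-injˡ (A ∷ As) (B ∷ Bs) = ⋁-aux-injˡ A As B Bs

  ⋁-injʳ : ∀ {n} {Δ : Ctx n} (As Bs : List⁺ (Form n)) →
           Δ ⊢ ⋁ Bs → Δ ⊢ ⋁ (As ⁺++⁺ Bs)
  ⋁-injʳ (A ∷ As) (B ∷ Bs) = ⋁-aux-injʳ A As B Bs

  instances : ∀ {n} → Form (suc n) → List⁺ (Term n) → Form n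
  instances A ms = ⋁ (List⁺.map (λ m → A [ m ]) ms)

  instances-⁺++⁺ : ∀ {n} {Δ : Ctx n} (A : Form (suc n)) ms ns →
                   Δ ⊢ ⋁ (List⁺.map (A [_]) ms ⁺++⁺ List⁺.map (A [_]) ns) →
                   Δ ⊢ instances A (ms ⁺++⁺ ns)
  instances-⁺++⁺ {Δ = Δ} A ms ns =
    subst (λ Bs → Δ ⊢ ⋁ Bs) (sym (map-⁺++⁺ (A [_]) ms ns))

  disjunction : ∀ {n} {Γ : Ctx n} {A : Form (suc n)} {u : Γ ⊢ ∃' A} {ms} →
                HNF u ms → Γ ⊢ instances A ms
  disjunction (hwit m v) = v
  disjunction {A = A} (hpar {ms = ms} {ns = ns} hu hv) =
    instances-⁺++⁺ A ms ns
      (par (⋁-injˡ As Bs (disjunction hu)) (⋁-injʳ As Bs (disjunction hv)))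
    where
    As Bs : List⁺ (Form _)
    As = List⁺.map (A [_]) ms
    Bs = List⁺.map (A [_]) ns

proposition4p2 : (S : Signature) → let open LC S in
    ∀ {n} {Γ : Ctx n} {A : Form (suc n)} (u : Γ ⊢ ∃' A) (ms : List⁺ (Term n)) →
    HNF u ms → Γ ⊢ ⋁ (List⁺.map (λ m → A [ m ]) ms)
proposition4p2 S u ms h = Herbrand.disjunction S h
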